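{- Let $k$ be an odd positive integer such that $5k+2$ is prime, and let $r\in\mathbb{N}$. Then $$F_{5k+r}\equiv F_r-2F_{r-1}\pmod{5k+2}.$$
   Context: $(F_n)_{n\ge 0}$ denotes the Fibonacci sequence: $F_0=0$, $F_1=1$, $F_{n+2}=F_{n+1}+F_n$. $\mathbb{N}$ denotes the natural numbers. -}

module Defs where

open import Data.Nat using (ℕ; zero; suc; _+_)

F : ℕ → ℕ
F zero = 0
F (suc zero) = 1
F (suc (suc n)) = F (suc n) + F n

-- F_{r-1} for r ∈ ℕ, using the standard extension F_{-1} = 1
-- (the unique value making F_1 = F_0 + F_{-1} hold).
Fpred : ℕ → ℕ
Fpred zero = 1
Fpred (suc r) = F r

{-# OPTIONS --safe #-}
module Submission where

-- Work in ℤ[C₅] = ℤ[ζ]/(ζ⁵ − 1), where φ = 1 + ζ + ζ⁴ plays the golden ratio: with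
-- N = 1 + ζ + ζ² + ζ³ + ζ⁴ one has φ² = φ + 1 + N and φN = 3N, so φⁿ = Fₙ φ + Fₙ₋₁ + cₙ N.
-- Modulo a prime p the Frobenius map x ↦ xᵖ is additive, and p ≡ 2 (mod 5) gives ζᵖ = ζ²,
-- hence φᵖ ≡ 1 + ζ² + ζ³ = −φ + 1 + N. Comparing coefficients yields Fₚ ≡ −1 and Fₚ₋₁ ≡ 1,
-- and since both sides of the claimed congruence are Fibonacci-like sequences in r, it
-- suffices that they agree at r = 0 and r = 1.

open import Algebra.Bundles using (CommutativeRing; CommutativeSemiring; Semiring)
open import Data.Nat.Base using (ℕ)

module PrimeBinomial where
  open import Data.Nat.Base using (suc; _+_; _*_; _<_; s≤s)
  open import Data.Nat.Properties using (*-zeroʳ; *-identityˡ; *-identityʳ; *-distribˡ-+; +-assoc; *-comm)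
  open import Data.Nat.Combinatorics using (_C_; nC1≡n; nCk+nC[k+1]≡[n+1]C[k+1])
  open import Data.Nat.Divisibility using (_∣_; divides; >⇒∤)
  open import Data.Nat.Primality using (Prime; euclidsLemma)
  open import Data.Sum.Base using (inj₁; inj₂)
  open import Relation.Nullary.Negation using (contradiction)
  open import Relation.Binary.PropositionalEquality using (_≡_; refl; sym; trans; cong; cong₂)
  open Relation.Binary.PropositionalEquality.≡-Reasoning

  [k+1]*[n+1]C[k+1]≡[n+1]*nCk : ∀ n k → suc k * (suc n C suc k) ≡ suc n * (n C k)
  [k+1]*[n+1]C[k+1]≡[n+1]*nCk 0       0       = refl
  [k+1]*[n+1]C[k+1]≡[n+1]*nCk 0       (suc k) = *-zeroʳ (suc (suc k))
  [k+1]*[n+1]C[k+1]≡[n+1]*nCk (suc n) 0       =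
    trans (*-identityˡ _) (trans (nC1≡n (suc (suc n))) (sym (*-identityʳ (suc (suc n)))))
  [k+1]*[n+1]C[k+1]≡[n+1]*nCk (suc n) (suc k) = begin
    suc (suc k) * (suc (suc n) C suc (suc k))
      ≡⟨ cong (suc (suc k) *_) (nCk+nC[k+1]≡[n+1]C[k+1] (suc n) (suc k)) ⟨
    suc (suc k) * (a + b)
      ≡⟨ *-distribˡ-+ (suc (suc k)) a b ⟩
    (a + suc k * a) + suc (suc k) * b
      ≡⟨ cong₂ (λ u v → (a + u) + v) ([k+1]*[n+1]C[k+1]≡[n+1]*nCk n k)
                                      ([k+1]*[n+1]C[k+1]≡[n+1]*nCk n (suc k)) ⟩
    (a + suc n * (n C k)) + suc n * (n C suc k)
      ≡⟨ +-assoc a _ _ ⟩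
    a + (suc n * (n C k) + suc n * (n C suc k))
      ≡⟨ cong (a +_) (*-distribˡ-+ (suc n) (n C k) (n C suc k)) ⟨
    a + suc n * (n C k + n C suc k)
      ≡⟨ cong (λ u → a + suc n * u) (nCk+nC[k+1]≡[n+1]C[k+1] n k) ⟩
    a + suc n * a ∎
    where
    a b : ℕ
    a = suc n C suc k
    b = suc n C suc (suc k)

  prime∣pC[k+1] : ∀ {q k} → Prime (suc q) → k < q → suc q ∣ suc q C suc k
  prime∣pC[k+1] {q} {k} p-prime k<q with euclidsLemma (suc k) (suc q C suc k) p-prime p∣[k+1]*pC[k+1]
    where
    p∣[k+1]*pC[k+1] : suc q ∣ suc k * (suc q C suc k)
    p∣[k+1]*pC[k+1] = divides (q C k) (trans ([k+1]*[n+1]C[k+1]≡[n+1]*nCk q k) (*-comm (suc q) (q C k)))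
  ... | inj₁ p∣k+1   = contradiction p∣k+1 (>⇒∤ (s≤s k<q))
  ... | inj₂ p∣pCk+1 = p∣pCk+1

module CharacteristicP {a ℓ} (S : CommutativeSemiring a ℓ) where
  open CommutativeSemiring S hiding (zero)
  open import Algebra.Properties.Semiring.Mult semiring using (_×_; ×-homo-1; ×-congʳ; ×-assocˡ; ×-assoc-*)
  open import Algebra.Properties.Semiring.Exp semiring using (_^_)
  open import Algebra.Properties.Monoid.Sum +-monoid using (sum; sum-cong-≋; sum-replicate-zero; sum-init-last)
  open import Algebra.Properties.CommutativeSemiring.Binomial S using (theorem; binomialTerm)
  open import Data.Nat.Base as ℕ using (suc; _<_)
  open import Data.Nat.Properties as ℕ using (n∸n≡0)
  open import Data.Nat.Combinatorics using (nCn≡1)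
  open import Data.Nat.Divisibility using (_∣_; divides)
  open import Data.Nat.Primality using (Prime)
  open import Data.Fin.Base using (Fin; zero; suc; fromℕ)
  open import Data.Fin.Properties using (toℕ<n; toℕ-fromℕ; toℕ-inject₁)
  open import Data.Vec.Functional using (init)
  open import Function.Base using (_∘_)
  open import Relation.Binary.PropositionalEquality as ≡ using (refl; cong; subst)
  open import Relation.Binary.Reasoning.Setoid setoid
  open PrimeBinomial using (prime∣pC[k+1])

  binomialTerm-first : ∀ x y n → binomialTerm x y n zero ≈ y ^ n
  binomialTerm-first x y n = trans (×-homo-1 _) (*-identityˡ _)

  binomialTerm-last : ∀ x y n → binomialTerm x y n (fromℕ n) ≈ x ^ n
  binomialTerm-last x y n rewrite toℕ-fromℕ n | nCn≡1 n | n∸n≡0 n = trans (×-homo-1 _) (*-identityʳ _)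

  p∣n⇒n×x≈0 : ∀ {p n} → p × 1# ≈ 0# → p ∣ n → ∀ x → n × x ≈ 0#
  p∣n⇒n×x≈0 {p} p×1≈0 (divides q refl) x = begin
    (q ℕ.* p) × x         ≡⟨ cong (_× x) (ℕ.*-comm q p) ⟩
    (p ℕ.* q) × x         ≈⟨ ×-assocˡ x p q ⟨
    p × (q × x)           ≈⟨ ×-congʳ p (*-identityˡ (q × x)) ⟨
    p × (1# * (q × x))    ≈⟨ ×-assoc-* p 1# (q × x) ⟨
    (p × 1#) * (q × x)    ≈⟨ *-congʳ p×1≈0 ⟩
    0# * (q × x)          ≈⟨ zeroˡ (q × x) ⟩
    0#                    ∎

  frobenius : ∀ {p} → Prime p → p × 1# ≈ 0# → ∀ x y → (x + y) ^ p ≈ x ^ p + y ^ p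
  frobenius {suc q} p-prime p×1≈0 x y = begin
    (x + y) ^ suc q                  ≈⟨ theorem (suc q) x y ⟩
    term zero + sum (term ∘ suc)     ≈⟨ +-cong (binomialTerm-first x y (suc q)) (sum-init-last (term ∘ suc)) ⟩
    y ^ suc q + (sum (init (term ∘ suc)) + term (fromℕ (suc q)))
                                     ≈⟨ +-congˡ (+-cong inner-terms-vanish (binomialTerm-last x y (suc q))) ⟩
    y ^ suc q + (0# + x ^ suc q)     ≈⟨ +-congˡ (+-identityˡ (x ^ suc q)) ⟩
    y ^ suc q + x ^ suc q            ≈⟨ +-comm (y ^ suc q) (x ^ suc q) ⟩
    x ^ suc q + y ^ suc q            ∎
    where
    term : Fin (suc (suc q)) → Carrier
    term = binomialTerm x y (suc q)
    inner-terms-vanish : sum (init (term ∘ suc)) ≈ 0#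
    inner-terms-vanish = trans (sum-cong-≋ (λ i → p∣n⇒n×x≈0 p×1≈0
        (prime∣pC[k+1] p-prime (subst (_< q) (≡.sym (toℕ-inject₁ i)) (toℕ<n i))) _))
      (sum-replicate-zero q)

module Periodicity {a ℓ} (S : Semiring a ℓ) where
  open Semiring S
  open import Algebra.Properties.Semiring.Exp S using (_^_; ^-congˡ; ^-homo-*; ^-assocʳ)
  open import Data.Nat.Base as ℕ using (zero; suc)
  open import Relation.Binary.Reasoning.Setoid setoid

  1#^n≈1# : ∀ n → 1# ^ n ≈ 1#
  1#^n≈1# zero    = refl
  1#^n≈1# (suc n) = trans (*-congˡ (1#^n≈1# n)) (*-identityˡ 1#)

  ^-periodic : ∀ x n → x ^ n ≈ 1# → ∀ k r → x ^ (n ℕ.* k ℕ.+ r) ≈ x ^ r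
  ^-periodic x n xⁿ≈1 k r = begin
    x ^ (n ℕ.* k ℕ.+ r)    ≈⟨ ^-homo-* x (n ℕ.* k) r ⟩
    x ^ (n ℕ.* k) * x ^ r  ≈⟨ *-congʳ (^-assocʳ x n k) ⟨
    (x ^ n) ^ k * x ^ r    ≈⟨ *-congʳ (trans (^-congˡ k xⁿ≈1) (1#^n≈1# k)) ⟩
    1# * x ^ r             ≈⟨ *-identityˡ (x ^ r) ⟩
    x ^ r                  ∎

module Modulo {c ℓ} (R : CommutativeRing c ℓ) (p : ℕ) where
  open CommutativeRing R
  open import Algebra.Properties.CommutativeSemigroup +-commutativeSemigroup using (interchange)
  open import Algebra.Properties.Semiring.Exp semiring using (_^_)
  open import Algebra.Properties.Semiring.Mult semiring using (_×_)
  open import Data.Nat.Base using (zero; suc)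
  open import Data.Product.Base using (_,_)
  open import Level using (_⊔_)
  open import Relation.Binary.PropositionalEquality as ≡ using (_≡_)
  open import Relation.Binary.Reasoning.Setoid setoid
  open import Relation.Binary.Structures using (IsEquivalence)

  p̂ : Carrier
  p̂ = p × 1#

  infix 4 _≈ₚ_
  record _≈ₚ_ (x y : Carrier) : Set (c ⊔ ℓ) where
    constructor _,_
    field
      cofactor   : Carrier
      difference : x ≈ y + p̂ * cofactor

  x≈x+p̂*0 : ∀ x → x ≈ x + p̂ * 0#
  x≈x+p̂*0 x = begin
    x            ≈⟨ +-identityʳ x ⟨
    x + 0#       ≈⟨ +-congˡ (zeroʳ p̂) ⟨
    x + p̂ * 0#   ∎

  ≈⇒≈ₚ : ∀ {x y} → x ≈ y → x ≈ₚ y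
  ≈⇒≈ₚ {y = y} x≈y = 0# , trans x≈y (x≈x+p̂*0 y)

  ≈ₚ-sym : ∀ {x y} → x ≈ₚ y → y ≈ₚ x
  ≈ₚ-sym {x} {y} (w , x≈y+p̂w) = - w , (begin
    y                        ≈⟨ x≈x+p̂*0 y ⟩
    y + p̂ * 0#               ≈⟨ +-congˡ (*-congˡ (-‿inverseʳ w)) ⟨
    y + p̂ * (w - w)          ≈⟨ +-congˡ (distribˡ p̂ w (- w)) ⟩
    y + (p̂ * w + p̂ * - w)    ≈⟨ +-assoc y (p̂ * w) (p̂ * - w) ⟨
    (y + p̂ * w) + p̂ * - w    ≈⟨ +-congʳ x≈y+p̂w ⟨
    x + p̂ * - w              ∎)

  ≈ₚ-trans : ∀ {x y z} → x ≈ₚ y → y ≈ₚ z → x ≈ₚ z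
  ≈ₚ-trans {x} {y} {z} (v , x≈y+p̂v) (w , y≈z+p̂w) = w + v , (begin
    x                        ≈⟨ x≈y+p̂v ⟩
    y + p̂ * v                ≈⟨ +-congʳ y≈z+p̂w ⟩
    (z + p̂ * w) + p̂ * v      ≈⟨ +-assoc z (p̂ * w) (p̂ * v) ⟩
    z + (p̂ * w + p̂ * v)      ≈⟨ +-congˡ (distribˡ p̂ w v) ⟨
    z + p̂ * (w + v)          ∎)

  +-congₚ : ∀ {x x′ y y′} → x ≈ₚ x′ → y ≈ₚ y′ → x + y ≈ₚ x′ + y′
  +-congₚ {x} {x′} {y} {y′} (v , x≈x′+p̂v) (w , y≈y′+p̂w) = v + w , (begin
    x + y                          ≈⟨ +-cong x≈x′+p̂v y≈y′+p̂w ⟩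
    (x′ + p̂ * v) + (y′ + p̂ * w)    ≈⟨ interchange x′ (p̂ * v) y′ (p̂ * w) ⟩
    (x′ + y′) + (p̂ * v + p̂ * w)    ≈⟨ +-congˡ (distribˡ p̂ v w) ⟨
    (x′ + y′) + p̂ * (v + w)        ∎)

  *-congʳₚ : ∀ {x x′} y → x ≈ₚ x′ → x * y ≈ₚ x′ * y
  *-congʳₚ {x} {x′} y (v , x≈x′+p̂v) = v * y , (begin
    x * y                  ≈⟨ *-congʳ x≈x′+p̂v ⟩
    (x′ + p̂ * v) * y       ≈⟨ distribʳ y x′ (p̂ * v) ⟩
    x′ * y + p̂ * v * y     ≈⟨ +-congˡ (*-assoc p̂ v y) ⟩
    x′ * y + p̂ * (v * y)   ∎)

  *-congₚ : ∀ {x x′ y y′} → x ≈ₚ x′ → y ≈ₚ y′ → x * y ≈ₚ x′ * y′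
  *-congₚ {x} {x′} {y} {y′} x≈ₚx′ y≈ₚy′ =
    ≈ₚ-trans (*-congʳₚ y x≈ₚx′) (≈ₚ-trans (≈⇒≈ₚ (*-comm x′ y))
      (≈ₚ-trans (*-congʳₚ x′ y≈ₚy′) (≈⇒≈ₚ (*-comm y′ x′))))

  ≈ₚ-isEquivalence : IsEquivalence _≈ₚ_
  ≈ₚ-isEquivalence = record { refl = ≈⇒≈ₚ refl ; sym = ≈ₚ-sym ; trans = ≈ₚ-trans }

  commutativeSemiringₚ : CommutativeSemiring c (c ⊔ ℓ)
  commutativeSemiringₚ = record
    { _≈_ = _≈ₚ_ ; _+_ = _+_ ; _*_ = _*_ ; 0# = 0# ; 1# = 1#
    ; isCommutativeSemiring = record
      { isSemiring = record
        { isSemiringWithoutAnnihilatingZero = record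
          { +-isCommutativeMonoid = record
            { isMonoid = record
              { isSemigroup = record
                { isMagma = record { isEquivalence = ≈ₚ-isEquivalence ; ∙-cong = +-congₚ }
                ; assoc = λ x y z → ≈⇒≈ₚ (+-assoc x y z) }
              ; identity = (λ x → ≈⇒≈ₚ (+-identityˡ x)) , (λ x → ≈⇒≈ₚ (+-identityʳ x)) }
            ; comm = λ x y → ≈⇒≈ₚ (+-comm x y) }
          ; *-cong = *-congₚ
          ; *-assoc = λ x y z → ≈⇒≈ₚ (*-assoc x y z)
          ; *-identity = (λ x → ≈⇒≈ₚ (*-identityˡ x)) , (λ x → ≈⇒≈ₚ (*-identityʳ x))
          ; distrib = (λ x y z → ≈⇒≈ₚ (distribˡ x y z)) , (λ x y z → ≈⇒≈ₚ (distribʳ x y z)) }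
        ; zero = (λ x → ≈⇒≈ₚ (zeroˡ x)) , (λ x → ≈⇒≈ₚ (zeroʳ x)) }
      ; *-comm = λ x y → ≈⇒≈ₚ (*-comm x y) } }

  open import Algebra.Properties.Semiring.Mult (CommutativeSemiring.semiring commutativeSemiringₚ)
    public using () renaming (_×_ to _×ₚ_)
  open import Algebra.Properties.Semiring.Exp (CommutativeSemiring.semiring commutativeSemiringₚ)
    public using () renaming (_^_ to _^ₚ_)

  -- R/pR shares the operations of R, but its × and ^ are separate definitions.
  ×ₚ≡× : ∀ n x → n ×ₚ x ≡ n × x
  ×ₚ≡× zero    x = ≡.refl
  ×ₚ≡× (suc n) x = ≡.cong (x +_) (×ₚ≡× n x)

  ^ₚ≡^ : ∀ x n → x ^ₚ n ≡ x ^ n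
  ^ₚ≡^ x zero    = ≡.refl
  ^ₚ≡^ x (suc n) = ≡.cong (x *_) (^ₚ≡^ x n)

  p×ₚ1≈ₚ0 : p ×ₚ 1# ≈ₚ 0#
  p×ₚ1≈ₚ0 = 1# , (begin
    p ×ₚ 1#        ≡⟨ ×ₚ≡× p 1# ⟩
    p̂              ≈⟨ *-identityʳ p̂ ⟨
    p̂ * 1#         ≈⟨ +-identityˡ (p̂ * 1#) ⟨
    0# + p̂ * 1#    ∎)

module FibonacciLike where
  open import Data.Integer.Base using (ℤ; +_; -1ℤ; _+_; _-_; _*_)
  open import Data.Integer.Divisibility.Signed using (_∣_; ∣m∣n⇒∣m+n; ∣m∣n⇒∣m-n)
  open import Data.Integer.Tactic.RingSolver using (solve-∀)
  open import Data.Nat.Base as ℕ using (zero; suc)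
  open import Data.Nat.Properties using (+-suc)
  open import Data.Product.Base using (_×_; _,_; proj₁)
  open import Defs using (F; Fpred)
  open import Relation.Binary.PropositionalEquality using (_≡_; refl; sym; subst)

  F[1+n]≡F[n]+Fpred[n] : ∀ n → F (suc n) ≡ F n ℕ.+ Fpred n
  F[1+n]≡F[n]+Fpred[n] zero    = refl
  F[1+n]≡F[n]+Fpred[n] (suc n) = refl

  FibonacciLike : (ℕ → ℤ) → Set
  FibonacciLike u = ∀ n → u (suc (suc n)) ≡ u (suc n) + u n

  fibonacciLike-∣ : ∀ {m} u → FibonacciLike u → m ∣ u 0 → m ∣ u 1 → ∀ n → m ∣ u n
  fibonacciLike-∣ {m} u u-rec m∣u₀ m∣u₁ n = proj₁ (consecutive n)
    where
    consecutive : ∀ n → m ∣ u n × m ∣ u (suc n)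
    consecutive zero    = m∣u₀ , m∣u₁
    consecutive (suc n) with consecutive n
    ... | m∣uₙ , m∣uₙ₊₁ = m∣uₙ₊₁ , subst (m ∣_) (sym (u-rec n)) (∣m∣n⇒∣m+n m∣uₙ₊₁ m∣uₙ)

  fibonacciLike-difference : ∀ u v → FibonacciLike u → FibonacciLike v → FibonacciLike (λ n → u n - v n)
  fibonacciLike-difference u v u-rec v-rec n rewrite u-rec n | v-rec n =
    interchange (u (suc n)) (u n) (v (suc n)) (v n)
    where
    interchange : ∀ a b c d → (a + b) - (c + d) ≡ (a - c) + (b - d)
    interchange = solve-∀

  fibonacciLike-congruent : ∀ {m} u v → FibonacciLike u → FibonacciLike v →
                            m ∣ u 0 - v 0 → m ∣ u 1 - v 1 → ∀ n → m ∣ u n - v n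
  fibonacciLike-congruent u v u-rec v-rec =
    fibonacciLike-∣ (λ n → u n - v n) (fibonacciLike-difference u v u-rec v-rec)

  F[N+r]≡F[r]-2Fpred[r] : ∀ {m} N → (m ∣ + F (N ℕ.+ 2) - -1ℤ) × (m ∣ + F (N ℕ.+ 1) - + 1) →
                          ∀ r → m ∣ + F (N ℕ.+ r) - (+ F r - + 2 * + Fpred r)
  F[N+r]≡F[r]-2Fpred[r] {m} N (F[N+2]≡-1 , F[N+1]≡1) =
    fibonacciLike-congruent shifted twisted shifted-rec twisted-rec F[N]≡-2 F[N+1]≡1
    where
    shifted twisted : ℕ → ℤ
    shifted r = + F (N ℕ.+ r)
    twisted r = + F r - + 2 * + Fpred r

    shifted-rec : FibonacciLike shifted
    shifted-rec r rewrite +-suc N (suc r) | +-suc N r = refl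

    twisted-rec : FibonacciLike twisted
    twisted-rec r rewrite F[1+n]≡F[n]+Fpred[n] r = identity (+ F r) (+ Fpred r)
      where
      identity : ∀ a b → ((a + b) + a) - + 2 * (a + b) ≡ ((a + b) - + 2 * a) + (a - + 2 * b)
      identity = solve-∀

    F[N]≡-2 : m ∣ shifted 0 - twisted 0
    F[N]≡-2 = subst (m ∣_) (identity (shifted 1) (shifted 0))
      (∣m∣n⇒∣m-n (subst (λ a → m ∣ a - -1ℤ) (shifted-rec 0) F[N+2]≡-1) F[N+1]≡1)
      where
      identity : ∀ a b → ((a + b) - -1ℤ) - (a - + 1) ≡ b - (+ 0 - + 2 * + 1)
      identity = solve-∀

module ℤ[C₅] where
  import Algebra.Properties.Semiring.Mult as Mult
  open import Data.Integer.Base using (ℤ; +_; -_; _+_; _*_)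
  open import Data.Integer.Tactic.RingSolver using (solve)
  open import Data.List.Base using (List; []; _∷_; _++_)
  open import Data.Nat.Base as ℕ using (zero; suc)
  open import Data.Product.Base using (∃; _×_; _,_)
  open import Defs using (F; Fpred)
  open import Function.Base using (_∘_)
  open import Level using (0ℓ)
  open import Relation.Binary.Core using (Rel)
  open import Relation.Binary.PropositionalEquality as ≡ using (_≡_; refl; cong; cong₂)
  open import Relation.Binary.Structures using (IsEquivalence)
  open FibonacciLike using (F[1+n]≡F[n]+Fpred[n])

  infix  4 _≋_
  infixl 6 _⊕_
  infixl 7 _⊗_
  infix  8 ⊝_

  -- ⟨ a₀ , a₁ , a₂ , a₃ , a₄ ⟩ stands for a₀ + a₁ζ + a₂ζ² + a₃ζ³ + a₄ζ⁴.
  data ℤ[C₅] : Set where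
    ⟨_,_,_,_,_⟩ : ℤ → ℤ → ℤ → ℤ → ℤ → ℤ[C₅]

  Pointwise : Rel ℤ 0ℓ → Rel ℤ[C₅] 0ℓ
  Pointwise _∼_ ⟨ a₀ , a₁ , a₂ , a₃ , a₄ ⟩ ⟨ b₀ , b₁ , b₂ , b₃ , b₄ ⟩ =
    a₀ ∼ b₀ × a₁ ∼ b₁ × a₂ ∼ b₂ × a₃ ∼ b₃ × a₄ ∼ b₄

  -- Ring laws hold up to coefficientwise equality, so each splits into five integer
  -- identities for the ring solver.
  _≋_ : Rel ℤ[C₅] 0ℓ
  _≋_ = Pointwise _≡_

  ≋⇒≡ : ∀ {x y} → x ≋ y → x ≡ y
  ≋⇒≡ {⟨ _ , _ , _ , _ , _ ⟩} {⟨ _ , _ , _ , _ , _ ⟩} (refl , refl , refl , refl , refl) = refl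

  ≡⇒≋ : ∀ {x y} → x ≡ y → x ≋ y
  ≡⇒≋ {⟨ _ , _ , _ , _ , _ ⟩} refl = refl , refl , refl , refl , refl

  ≋-isEquivalence : IsEquivalence _≋_
  ≋-isEquivalence = record
    { refl  = ≡⇒≋ refl
    ; sym   = ≡⇒≋ ∘ ≡.sym ∘ ≋⇒≡
    ; trans = λ x≋y y≋z → ≡⇒≋ (≡.trans (≋⇒≡ x≋y) (≋⇒≡ y≋z))
    }

  0# 1# : ℤ[C₅]
  0# = ⟨ + 0 , + 0 , + 0 , + 0 , + 0 ⟩
  1# = ⟨ + 1 , + 0 , + 0 , + 0 , + 0 ⟩

  _⊕_ : ℤ[C₅] → ℤ[C₅] → ℤ[C₅]
  ⟨ a₀ , a₁ , a₂ , a₃ , a₄ ⟩ ⊕ ⟨ b₀ , b₁ , b₂ , b₃ , b₄ ⟩ =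
    ⟨ a₀ + b₀ , a₁ + b₁ , a₂ + b₂ , a₃ + b₃ , a₄ + b₄ ⟩

  ⊝_ : ℤ[C₅] → ℤ[C₅]
  ⊝ ⟨ a₀ , a₁ , a₂ , a₃ , a₄ ⟩ = ⟨ - a₀ , - a₁ , - a₂ , - a₃ , - a₄ ⟩

  _⊗_ : ℤ[C₅] → ℤ[C₅] → ℤ[C₅]
  ⟨ a₀ , a₁ , a₂ , a₃ , a₄ ⟩ ⊗ ⟨ b₀ , b₁ , b₂ , b₃ , b₄ ⟩ = ⟨
    a₀ * b₀ + a₁ * b₄ + a₂ * b₃ + a₃ * b₂ + a₄ * b₁ ,
    a₀ * b₁ + a₁ * b₀ + a₂ * b₄ + a₃ * b₃ + a₄ * b₂ ,
    a₀ * b₂ + a₁ * b₁ + a₂ * b₀ + a₃ * b₄ + a₄ * b₃ ,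
    a₀ * b₃ + a₁ * b₂ + a₂ * b₁ + a₃ * b₀ + a₄ * b₄ ,
    a₀ * b₄ + a₁ * b₃ + a₂ * b₂ + a₃ * b₁ + a₄ * b₀ ⟩

  private
    coefficients : ℤ[C₅] → List ℤ
    coefficients ⟨ a₀ , a₁ , a₂ , a₃ , a₄ ⟩ = a₀ ∷ a₁ ∷ a₂ ∷ a₃ ∷ a₄ ∷ []

  ⊕-assoc : ∀ x y z → (x ⊕ y) ⊕ z ≋ x ⊕ (y ⊕ z)
  ⊕-assoc x@(⟨ _ , _ , _ , _ , _ ⟩) y@(⟨ _ , _ , _ , _ , _ ⟩) z@(⟨ _ , _ , _ , _ , _ ⟩) =
    solve vs , solve vs , solve vs , solve vs , solve vs
    where
    vs : List ℤ
    vs = coefficients x ++ coefficients y ++ coefficients z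

  ⊕-comm : ∀ x y → x ⊕ y ≋ y ⊕ x
  ⊕-comm x@(⟨ _ , _ , _ , _ , _ ⟩) y@(⟨ _ , _ , _ , _ , _ ⟩) =
    solve vs , solve vs , solve vs , solve vs , solve vs
    where
    vs : List ℤ
    vs = coefficients x ++ coefficients y

  ⊕-identityˡ : ∀ x → 0# ⊕ x ≋ x
  ⊕-identityˡ x@(⟨ _ , _ , _ , _ , _ ⟩) =
    solve vs , solve vs , solve vs , solve vs , solve vs
    where
    vs : List ℤ
    vs = coefficients x

  ⊕-identityʳ : ∀ x → x ⊕ 0# ≋ x
  ⊕-identityʳ x@(⟨ _ , _ , _ , _ , _ ⟩) =
    solve vs , solve vs , solve vs , solve vs , solve vs
    where
    vs : List ℤ
    vs = coefficients x

  ⊝-inverseˡ : ∀ x → ⊝ x ⊕ x ≋ 0#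
  ⊝-inverseˡ x@(⟨ _ , _ , _ , _ , _ ⟩) =
    solve vs , solve vs , solve vs , solve vs , solve vs
    where
    vs : List ℤ
    vs = coefficients x

  ⊝-inverseʳ : ∀ x → x ⊕ ⊝ x ≋ 0#
  ⊝-inverseʳ x@(⟨ _ , _ , _ , _ , _ ⟩) =
    solve vs , solve vs , solve vs , solve vs , solve vs
    where
    vs : List ℤ
    vs = coefficients x

  ⊗-assoc : ∀ x y z → (x ⊗ y) ⊗ z ≋ x ⊗ (y ⊗ z)
  ⊗-assoc x@(⟨ _ , _ , _ , _ , _ ⟩) y@(⟨ _ , _ , _ , _ , _ ⟩) z@(⟨ _ , _ , _ , _ , _ ⟩) =
    solve vs , solve vs , solve vs , solve vs , solve vs
    where
    vs : List ℤ
    vs = coefficients x ++ coefficients y ++ coefficients z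

  ⊗-comm : ∀ x y → x ⊗ y ≋ y ⊗ x
  ⊗-comm x@(⟨ _ , _ , _ , _ , _ ⟩) y@(⟨ _ , _ , _ , _ , _ ⟩) =
    solve vs , solve vs , solve vs , solve vs , solve vs
    where
    vs : List ℤ
    vs = coefficients x ++ coefficients y

  ⊗-identityˡ : ∀ x → 1# ⊗ x ≋ x
  ⊗-identityˡ x@(⟨ _ , _ , _ , _ , _ ⟩) =
    solve vs , solve vs , solve vs , solve vs , solve vs
    where
    vs : List ℤ
    vs = coefficients x

  ⊗-identityʳ : ∀ x → x ⊗ 1# ≋ x
  ⊗-identityʳ x@(⟨ _ , _ , _ , _ , _ ⟩) =
    solve vs , solve vs , solve vs , solve vs , solve vs
    where
    vs : List ℤ
    vs = coefficients x

  ⊗-distribˡ-⊕ : ∀ x y z → x ⊗ (y ⊕ z) ≋ x ⊗ y ⊕ x ⊗ z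
  ⊗-distribˡ-⊕ x@(⟨ _ , _ , _ , _ , _ ⟩) y@(⟨ _ , _ , _ , _ , _ ⟩) z@(⟨ _ , _ , _ , _ , _ ⟩) =
    solve vs , solve vs , solve vs , solve vs , solve vs
    where
    vs : List ℤ
    vs = coefficients x ++ coefficients y ++ coefficients z

  ⊗-distribʳ-⊕ : ∀ x y z → (y ⊕ z) ⊗ x ≋ y ⊗ x ⊕ z ⊗ x
  ⊗-distribʳ-⊕ x@(⟨ _ , _ , _ , _ , _ ⟩) y@(⟨ _ , _ , _ , _ , _ ⟩) z@(⟨ _ , _ , _ , _ , _ ⟩) =
    solve vs , solve vs , solve vs , solve vs , solve vs
    where
    vs : List ℤ
    vs = coefficients x ++ coefficients y ++ coefficients z

  ≋-cong₂ : ∀ (_∙_ : ℤ[C₅] → ℤ[C₅] → ℤ[C₅]) {x x′ y y′} → x ≋ x′ → y ≋ y′ → (x ∙ y) ≋ (x′ ∙ y′)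
  ≋-cong₂ _∙_ x≋x′ y≋y′ = ≡⇒≋ (cong₂ _∙_ (≋⇒≡ x≋x′) (≋⇒≡ y≋y′))

  commutativeRing : CommutativeRing 0ℓ 0ℓ
  commutativeRing = record
    { Carrier = ℤ[C₅] ; _≈_ = _≋_ ; _+_ = _⊕_ ; _*_ = _⊗_ ; -_ = ⊝_ ; 0# = 0# ; 1# = 1#
    ; isCommutativeRing = record
      { isRing = record
        { +-isAbelianGroup = record
          { isGroup = record
            { isMonoid = record
              { isSemigroup = record
                { isMagma = record { isEquivalence = ≋-isEquivalence ; ∙-cong = ≋-cong₂ _⊕_ }
                ; assoc = ⊕-assoc }
              ; identity = ⊕-identityˡ , ⊕-identityʳ }
            ; inverse = ⊝-inverseˡ , ⊝-inverseʳ
            ; ⁻¹-cong = ≡⇒≋ ∘ ≡.cong ⊝_ ∘ ≋⇒≡ }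
          ; comm = ⊕-comm }
        ; *-cong = ≋-cong₂ _⊗_
        ; *-assoc = ⊗-assoc
        ; *-identity = ⊗-identityˡ , ⊗-identityʳ
        ; distrib = ⊗-distribˡ-⊕ , ⊗-distribʳ-⊕ }
      ; *-comm = ⊗-comm } }

  open CommutativeRing commutativeRing using (setoid; *-congˡ)
  open import Algebra.Properties.Semiring.Exp (CommutativeRing.semiring commutativeRing) using (_^_)
  private module Multiples = Mult (CommutativeRing.semiring commutativeRing)

  n×1#≡⟨n,0,0,0,0⟩ : ∀ n → n Multiples.× 1# ≡ ⟨ + n , + 0 , + 0 , + 0 , + 0 ⟩
  n×1#≡⟨n,0,0,0,0⟩ zero    = refl
  n×1#≡⟨n,0,0,0,0⟩ (suc n) = cong (1# ⊕_) (n×1#≡⟨n,0,0,0,0⟩ n)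

  infixr 7 _·_
  _·_ : ℤ → ℤ[C₅] → ℤ[C₅]
  m · ⟨ a₀ , a₁ , a₂ , a₃ , a₄ ⟩ = ⟨ m * a₀ , m * a₁ , m * a₂ , m * a₃ , m * a₄ ⟩

  ⟨m,0,0,0,0⟩⊗x≋m·x : ∀ m x → ⟨ m , + 0 , + 0 , + 0 , + 0 ⟩ ⊗ x ≋ m · x
  ⟨m,0,0,0,0⟩⊗x≋m·x m x@(⟨ _ , _ , _ , _ , _ ⟩) = solve vs , solve vs , solve vs , solve vs , solve vs
    where
    vs : List ℤ
    vs = m ∷ coefficients x

  ζ ζ⁴ φ : ℤ[C₅]
  ζ  = ⟨ + 0 , + 1 , + 0 , + 0 , + 0 ⟩
  ζ⁴ = ⟨ + 0 , + 0 , + 0 , + 0 , + 1 ⟩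
  φ  = 1# ⊕ (ζ ⊕ ζ⁴)

  -- f φ + g + c N, where N = 1 + ζ + ζ² + ζ³ + ζ⁴.
  fibonacci-form : ℤ → ℤ → ℤ → ℤ[C₅]
  fibonacci-form f g c = ⟨ f + g + c , f + c , c , c , f + c ⟩

  φ⊗fibonacci-form : ∀ f g c → φ ⊗ fibonacci-form f g c ≋ fibonacci-form (f + g) f (f + + 3 * c)
  φ⊗fibonacci-form f g c = solve vs , solve vs , solve vs , solve vs , solve vs
    where
    vs : List ℤ
    vs = f ∷ g ∷ c ∷ []

  φ^n≋fibonacci-form : ∀ n → ∃ λ c → φ ^ n ≋ fibonacci-form (+ F n) (+ Fpred n) c
  φ^n≋fibonacci-form zero    = + 0 , ≡⇒≋ refl
  φ^n≋fibonacci-form (suc n) with φ^n≋fibonacci-form n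
  ... | c , φⁿ≋ = + F n + + 3 * c , (begin
    φ ⊗ φ ^ n                                                  ≈⟨ *-congˡ φⁿ≋ ⟩
    φ ⊗ fibonacci-form (+ F n) (+ Fpred n) c                   ≈⟨ φ⊗fibonacci-form (+ F n) (+ Fpred n) c ⟩
    fibonacci-form (+ (F n ℕ.+ Fpred n)) (+ F n) (+ F n + + 3 * c)
      ≡⟨ cong (λ f → fibonacci-form (+ f) (+ F n) (+ F n + + 3 * c)) (F[1+n]≡F[n]+Fpred[n] n) ⟨
    fibonacci-form (+ F (suc n)) (+ F n) (+ F n + + 3 * c)     ∎)
    where open import Relation.Binary.Reasoning.Setoid setoid

module ℤ[C₅]-Modulo (p : ℕ) where
  open ℤ[C₅]
  open CommutativeRing commutativeRing using (trans; +-congˡ)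
  open Modulo commutativeRing p
  open import Data.Integer.Base using (+_; _+_; _-_; _*_)
  open import Data.Integer.Divisibility.Signed using (_∣_; divides; ∣m∣n⇒∣m-n)
  open import Data.Integer.Tactic.RingSolver using (solve-∀)
  open import Data.Product.Base using (_×_; _,_)
  open import Defs using (F; Fpred)
  open import Relation.Binary.PropositionalEquality as ≡ using (_≡_; refl; cong; subst)

  a≡b+m*w⇒m∣a-b : ∀ {m a b w} → a ≡ b + m * w → m ∣ a - b
  a≡b+m*w⇒m∣a-b {m} {b = b} {w} refl = divides w (b+mw-b≡wm b m w)
    where
    b+mw-b≡wm : ∀ b m w → (b + m * w) - b ≡ w * m
    b+mw-b≡wm = solve-∀

  ≈ₚ⇒coefficientwise : ∀ {x y} → x ≈ₚ y → Pointwise (λ a b → + p ∣ a - b) x y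
  ≈ₚ⇒coefficientwise {x} {y} (w , x≋y+p̂w) = divisible x y w x≋y+p·w
    where
    x≋y+p·w : x ≋ y ⊕ + p · w
    x≋y+p·w = trans x≋y+p̂w
      (+-congˡ (trans (≡⇒≋ (cong (_⊗ w) (n×1#≡⟨n,0,0,0,0⟩ p))) (⟨m,0,0,0,0⟩⊗x≋m·x (+ p) w)))
    divisible : ∀ x y w → x ≋ y ⊕ + p · w → Pointwise (λ a b → + p ∣ a - b) x y
    divisible ⟨ _ , _ , _ , _ , _ ⟩ ⟨ _ , _ , _ , _ , _ ⟩ ⟨ _ , _ , _ , _ , _ ⟩ (e₀ , e₁ , e₂ , e₃ , e₄) =
      a≡b+m*w⇒m∣a-b e₀ , a≡b+m*w⇒m∣a-b e₁ , a≡b+m*w⇒m∣a-b e₂ , a≡b+m*w⇒m∣a-b e₃ , a≡b+m*w⇒m∣a-b e₄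

  fibonacci-form-≈ₚ : ∀ {f g c f′ g′ c′} → fibonacci-form f g c ≈ₚ fibonacci-form f′ g′ c′ →
                      (+ p ∣ f - f′) × (+ p ∣ g - g′)
  fibonacci-form-≈ₚ {f} {g} {c} {f′} {g′} {c′} eq with ≈ₚ⇒coefficientwise eq
  ... | p∣₀ , p∣₁ , p∣₂ , _ =
    subst (+ p ∣_) (f-identity f c f′ c′) (∣m∣n⇒∣m-n p∣₁ p∣₂) ,
    subst (+ p ∣_) (g-identity f g c f′ g′ c′) (∣m∣n⇒∣m-n p∣₀ p∣₁)
    where
    f-identity : ∀ f c f′ c′ → ((f + c) - (f′ + c′)) - (c - c′) ≡ f - f′
    f-identity = solve-∀
    g-identity : ∀ f g c f′ g′ c′ → ((f + g + c) - (f′ + g′ + c′)) - ((f + c) - (f′ + c′)) ≡ g - g′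
    g-identity = solve-∀

  φ^n≈ₚfibonacci-form⇒ : ∀ n {f g c} → φ ^ₚ n ≈ₚ fibonacci-form f g c →
                          (+ p ∣ + F n - f) × (+ p ∣ + Fpred n - g)
  φ^n≈ₚfibonacci-form⇒ n {f} {g} {c} φⁿ≈ₚ with φ^n≋fibonacci-form n
  ... | c′ , φⁿ≋ = fibonacci-form-≈ₚ {+ F n} {+ Fpred n} {c′} {f} {g} {c} (≈ₚ-trans (≈ₚ-sym φⁿ≈ₚ′) φⁿ≈ₚ)
    where
    φⁿ≈ₚ′ : φ ^ₚ n ≈ₚ fibonacci-form (+ F n) (+ Fpred n) c′
    φⁿ≈ₚ′ = ≈⇒≈ₚ (subst (_≋ fibonacci-form (+ F n) (+ Fpred n) c′) (≡.sym (^ₚ≡^ φ n)) φⁿ≋)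

module FibonacciModPrime where
  open ℤ[C₅]
  open import Data.Integer.Base using (+_; -1ℤ; _-_)
  open import Data.Integer.Divisibility.Signed using (_∣_)
  open import Data.Nat.Base using (_+_; _*_)
  open import Data.Nat.Primality using (Prime)
  open import Data.Nat.Properties using (+-suc)
  open import Data.Product.Base using (_×_; map₂)
  open import Defs using (F; Fpred)
  open import Relation.Binary.PropositionalEquality using (refl; cong; subst)

  prime[5k+2]⇒F[p]≡-1∧F[p-1]≡1 : ∀ k → Prime (5 * k + 2) →
    (+ (5 * k + 2) ∣ + F (5 * k + 2) - -1ℤ) × (+ (5 * k + 2) ∣ + F (5 * k + 1) - + 1)
  prime[5k+2]⇒F[p]≡-1∧F[p-1]≡1 k p-prime =
    map₂ (subst (λ n → + p ∣ + n - + 1) (cong Fpred (+-suc (5 * k) 1)))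
      (φ^n≈ₚfibonacci-form⇒ p { -1ℤ} {+ 1} {+ 1} φᵖ≈ₚ1+ζ²+ζ³)
    where
    p : ℕ
    p = 5 * k + 2
    open Modulo commutativeRing p
    open ℤ[C₅]-Modulo p
    open CommutativeSemiring commutativeSemiringₚ using (setoid; +-cong; +-congˡ)
    open CharacteristicP commutativeSemiringₚ using (frobenius)
    open Periodicity (CommutativeSemiring.semiring commutativeSemiringₚ) using (1#^n≈1#; ^-periodic)
    open import Relation.Binary.Reasoning.Setoid setoid

    ζ^5≈ₚ1 : ζ ^ₚ 5 ≈ₚ 1#
    ζ^5≈ₚ1 = ≈⇒≈ₚ (≡⇒≋ {ζ ^ₚ 5} refl)

    ζ⁴^5≈ₚ1 : ζ⁴ ^ₚ 5 ≈ₚ 1#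
    ζ⁴^5≈ₚ1 = ≈⇒≈ₚ (≡⇒≋ {ζ⁴ ^ₚ 5} refl)

    φᵖ≈ₚ1+ζ²+ζ³ : φ ^ₚ p ≈ₚ fibonacci-form -1ℤ (+ 1) (+ 1)
    φᵖ≈ₚ1+ζ²+ζ³ = begin
      (1# ⊕ (ζ ⊕ ζ⁴)) ^ₚ p             ≈⟨ frobenius p-prime p×ₚ1≈ₚ0 1# (ζ ⊕ ζ⁴) ⟩
      1# ^ₚ p ⊕ (ζ ⊕ ζ⁴) ^ₚ p          ≈⟨ +-cong (1#^n≈1# p) (frobenius p-prime p×ₚ1≈ₚ0 ζ ζ⁴) ⟩
      1# ⊕ (ζ ^ₚ p ⊕ ζ⁴ ^ₚ p)          ≈⟨ +-congˡ (+-cong (^-periodic ζ 5 ζ^5≈ₚ1 k 2) (^-periodic ζ⁴ 5 ζ⁴^5≈ₚ1 k 2)) ⟩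
      1# ⊕ (ζ ^ₚ 2 ⊕ ζ⁴ ^ₚ 2)          ≡⟨⟩
      fibonacci-form -1ℤ (+ 1) (+ 1)   ∎

open import Defs
open import Data.Nat using (ℕ; _+_; _*_)
open import Data.Nat.Primality using (Prime)
open import Data.Integer using (ℤ; +_; _-_) renaming (_*_ to _*ℤ_)
open import Data.Integer.Divisibility using (_∣_)
open import Data.Product using (∃)
open import Relation.Binary.PropositionalEquality using (_≡_)
open import Data.Integer.Divisibility.Signed using (∣⇒∣ᵤ)
open FibonacciModPrime using (prime[5k+2]⇒F[p]≡-1∧F[p-1]≡1)
open FibonacciLike using (F[N+r]≡F[r]-2Fpred[r])

lemma3p10 : (k : ℕ) → (∃ λ m → k ≡ 2 * m + 1) → Prime (5 * k + 2) → (r : ℕ) →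
    (+ (5 * k + 2)) ∣ ((+ F (5 * k + r)) - ((+ F r) - (+ 2) *ℤ (+ Fpred r)))
lemma3p10 k _ p-prime r =
  ∣⇒∣ᵤ (F[N+r]≡F[r]-2Fpred[r] (5 * k) (prime[5k+2]⇒F[p]≡-1∧F[p-1]≡1 k p-prime) r)
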